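{- Let $G$ be a connected graph with $n$ vertices and positive edge lengths $\ell$, let $H$ be a subgraph of $G$, let $\delta$ be a real number with $0<\delta\le\varepsilon(G,\ell)$, and let $\hat d_G$ be the distance in $G$ with respect to the edge lengths $\hat\ell$. Then $H$ is a (geodesically) convex subgraph of $G$ if and only if \[ \sum_{x,y\in V(H)}\hat d_G(x,y)=\sum_{x,y\in V(H)} d_H(x,y). \]
   Context: For a graph $F$, $d_F(x,y)$ is the minimum $\ell$-length of an $x$-to-$y$ path in $F$ ($+\infty$ if none). $H$ is convex in $G$ if for all $x,y\in V(H)$ every shortest (w.r.t. $\ell$) $x$-to-$y$ path of $G$ is contained in $H$. Define $\varepsilon(G,\ell)=\frac{1}{n}\min\{\ell(\pi)-\ell(\pi')\mid \pi,\pi' \text{ paths in } G,\ \ell(\pi)>\ell(\pi')\}$. Define $\hat\ell(e)=\ell(e)$ for $e\in E(H)$ and $\hat\ell(e)=\ell(e)-\delta$ for $e\in E(G)\setminus E(H)$. Sums range over ordered pairs. -}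

module Defs where

open import Level using (0ℓ)
open import Data.Nat using (ℕ; zero; suc)
open import Data.Fin using (Fin)
open import Data.Bool using (Bool; true; false; T; if_then_else_)
open import Data.Maybe using (Maybe; just; nothing)
open import Data.List using (List; []; _∷_; foldr; map; filterᵇ; allFin)
open import Data.List.Relation.Unary.Unique.Propositional using (Unique)
open import Data.Product using (Σ; ∃; _×_; _,_)
open import Data.Sum using (_⊎_)
open import Data.Empty using (⊥)
open import Relation.Nullary using (¬_)
open import Relation.Binary.Core using (Rel)
open import Relation.Binary.Structures using (IsStrictTotalOrder)
open import Relation.Binary.PropositionalEquality using (_≡_; _≢_)
open import Algebra.Structures using (IsCommutativeRing)

-- Ordered fields (the real numbers are one; the standard library has no
-- reals, so the statement is made over an arbitrary ordered field).

record OrderedField : Set₁ where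
  infixl 6 _+_ _-_
  infixl 7 _*_
  infix 4 _<_ _≤_
  field
    Carrier : Set
    _+_ _*_ : Carrier → Carrier → Carrier
    -_      : Carrier → Carrier
    0# 1#   : Carrier
    isCommutativeRing : IsCommutativeRing _≡_ _+_ _*_ -_ 0# 1#
    _<_     : Rel Carrier 0ℓ
    isStrictTotalOrder : IsStrictTotalOrder _≡_ _<_
    +-mono-< : ∀ {x y} z → x < y → x + z < y + z
    *-pos    : ∀ {x y} → 0# < x → 0# < y → 0# < x * y
    inverse  : ∀ x → x ≢ 0# → Σ Carrier (λ y → x * y ≡ 1#)
    0≢1      : 0# ≢ 1#

  _-_ : Carrier → Carrier → Carrier
  x - y = x + (- y)

  _≤_ : Carrier → Carrier → Set
  x ≤ y = (x < y) ⊎ (x ≡ y)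

  _·_ : ℕ → Carrier → Carrier
  zero  · x = 0#
  suc n · x = x + n · x

record Graph (n : ℕ) : Set where
  field
    E      : Fin n → Fin n → Bool
    E-sym  : ∀ x y → E x y ≡ E y x
    E-irr  : ∀ x → E x x ≡ false

record Subgraph {n : ℕ} (G : Graph n) : Set where
  open Graph G
  field
    V      : Fin n → Bool
    EH     : Fin n → Fin n → Bool
    EH-sym : ∀ x y → EH x y ≡ EH y x
    EH⊆E   : ∀ x y → T (EH x y) → T (E x y)
    EH-end : ∀ x y → T (EH x y) → T (V x) × T (V y)

data Walk {n : ℕ} (A : Fin n → Fin n → Bool) : Fin n → Fin n → Set where
  [_]  : ∀ x → Walk A x x
  step : ∀ {x y z} → T (A x y) → Walk A y z → Walk A x z

module _ {n : ℕ} {A : Fin n → Fin n → Bool} where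

  vertices : ∀ {x y} → Walk A x y → List (Fin n)
  vertices [ x ]                  = x ∷ []
  vertices (step {x = x} _ w)     = x ∷ vertices w

  edges : ∀ {x y} → Walk A x y → List (Fin n × Fin n)
  edges [ x ]                        = []
  edges (step {x = x} {y = y} _ w)   = (x , y) ∷ edges w

  IsPath : ∀ {x y} → Walk A x y → Set
  IsPath w = Unique (vertices w)

record Path {n : ℕ} (A : Fin n → Fin n → Bool) (x y : Fin n) : Set where
  constructor mkPath
  field
    walk   : Walk A x y
    isPath : IsPath walk

module Over (𝔽 : OrderedField) where
  open OrderedField 𝔽

  -- extended values: nothing = +∞
  F∞ : Set
  F∞ = Maybe Carrier

  _+∞_ : F∞ → F∞ → F∞
  just a  +∞ just b = just (a + b)
  _       +∞ _      = nothing

  len : ∀ {n} {A : Fin n → Fin n → Bool} {x y} →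
        (Fin n → Fin n → Carrier) → Walk A x y → Carrier
  len ℓ [ x ]                         = 0#
  len ℓ (step {x = x} {y = y} _ w)    = ℓ x y + len ℓ w

  plen : ∀ {n} {A : Fin n → Fin n → Bool} {x y} →
         (Fin n → Fin n → Carrier) → Path A x y → Carrier
  plen ℓ p = len ℓ (Path.walk p)

  -- IsDist A ℓ x y d :  d = d_F(x,y), the minimum ℓ-length of an
  -- x-to-y path in the graph with edge relation A (+∞ if none).
  IsDist : ∀ {n} → (Fin n → Fin n → Bool) → (Fin n → Fin n → Carrier) →
           Fin n → Fin n → F∞ → Set
  IsDist A ℓ x y nothing  = ¬ Path A x y
  IsDist A ℓ x y (just v) =
    Σ (Path A x y) (λ p → plen ℓ p ≡ v) × (∀ (p : Path A x y) → v ≤ plen ℓ p)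

  PositiveLengths : ∀ {n} → Graph n → (Fin n → Fin n → Carrier) → Set
  PositiveLengths {n} G ℓ =
    (∀ x y → ℓ x y ≡ ℓ y x) × (∀ (x y : Fin n) → T (Graph.E G x y) → 0# < ℓ x y)

  Connected : ∀ {n} → Graph n → Set
  Connected {n} G = ∀ (x y : Fin n) → Path (Graph.E G) x y

  -- δ ≤ ε(G,ℓ), where ε(G,ℓ) = (1/n) min { ℓ(π) - ℓ(π') | ℓ(π) > ℓ(π') }
  -- (min ∅ = +∞); unfolded: n·δ ≤ ℓ(π) - ℓ(π') for all such pairs.
  δ≤ε : ∀ {n} → Graph n → (Fin n → Fin n → Carrier) → Carrier → Set
  δ≤ε {n} G ℓ δ =
    ∀ {x y x′ y′} (π : Path (Graph.E G) x y) (π′ : Path (Graph.E G) x′ y′) →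
      plen ℓ π′ < plen ℓ π → n · δ ≤ plen ℓ π - plen ℓ π′

  hat : ∀ {n} {G : Graph n} → Subgraph G → (Fin n → Fin n → Carrier) →
        Carrier → Fin n → Fin n → Carrier
  hat H ℓ δ x y = if Subgraph.EH H x y then ℓ x y else ℓ x y - δ

  Shortest : ∀ {n} (G : Graph n) → (Fin n → Fin n → Carrier) →
             ∀ {x y} → Path (Graph.E G) x y → Set
  Shortest G ℓ {x} {y} π = ∀ (π′ : Path (Graph.E G) x y) → plen ℓ π ≤ plen ℓ π′

  data AllL {A : Set} (P : A → Set) : List A → Set where
    []  : AllL P []
    _∷_ : ∀ {a as} → P a → AllL P as → AllL P (a ∷ as)

  ContainedIn : ∀ {n} {G : Graph n} → Subgraph G → ∀ {x y} →
                Path (Graph.E G) x y → Set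
  ContainedIn H π =
    AllL (λ v → T (Subgraph.V H v)) (vertices (Path.walk π)) ×
    AllL (λ e → T (Subgraph.EH H (Data.Product.proj₁ e) (Data.Product.proj₂ e)))
         (edges (Path.walk π))

  Convex : ∀ {n} {G : Graph n} → Subgraph G → (Fin n → Fin n → Carrier) → Set
  Convex {n} {G} H ℓ =
    ∀ (x y : Fin n) → T (Subgraph.V H x) → T (Subgraph.V H y) →
    ∀ (π : Path (Graph.E G) x y) → Shortest G ℓ π → ContainedIn H π

  sumV : ∀ {n} → (Fin n → Bool) → (Fin n → Fin n → F∞) → F∞
  sumV {n} V f =
    foldr _+∞_ (just 0#)
      (map (λ x → foldr _+∞_ (just 0#) (map (f x) (filterᵇ V (allFin n))))
           (filterᵇ V (allFin n)))

{-# OPTIONS --safe #-}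
module Submission where

open import Defs
open import Data.Nat using (ℕ)
open import Data.Fin using (Fin)
open import Function.Bundles using (_⇔_; mk⇔; Equivalence)
open import Relation.Binary.PropositionalEquality using (_≡_; _≢_; refl; sym; trans; cong; cong₂; subst)

open import Level using (0ℓ)
open import Algebra.Bundles using (CommutativeRing)
import Algebra.Properties.CommutativeSemigroup as CommutativeSemigroupProperties
import Algebra.Properties.Group as GroupProperties
open import Data.Bool using (Bool; true; false; T; if_then_else_)
open import Data.Bool.Properties using (T?; T-≡)
open import Data.Empty using (⊥)
import Data.Fin as Fin
open import Data.Fin.Properties using (injective⇒≤)
open import Data.List using (List; []; _∷_; foldr; map; filterᵇ; allFin; length; lookup)
open import Data.List.Membership.Propositional.Properties using (∈-lookup; ∈-filter⁺; ∈-filter⁻; ∈-allFin)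
open import Data.List.Relation.Unary.All as All using (All; []; _∷_)
open import Data.List.Relation.Unary.AllPairs using (_∷_)
open import Data.List.Relation.Unary.Unique.Propositional using (Unique)
open import Data.Maybe using (just; nothing)
open import Data.Maybe.Properties using (just-injective)
import Data.Nat as ℕ
import Data.Nat.Properties as ℕ
open import Data.Product using (_×_; _,_; proj₁; proj₂)
open import Data.Sum using (inj₁; inj₂)
open import Data.Unit using (⊤; tt)
open import Function.Base using (_∘_)
import Function.Properties.Equivalence as ⇔
open import Function.Definitions using (Injective)
open import Relation.Binary.Bundles using (StrictPartialOrder)
import Relation.Binary.Construct.StrictToNonStrict as StrictToNonStrict
open import Relation.Binary.Definitions using (tri<; tri≈; tri>)
import Relation.Binary.Reasoning.StrictPartialOrder as StrictPartialOrderReasoning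
open import Relation.Binary.Structures using (IsStrictTotalOrder)
open import Relation.Nullary using (¬_; yes; no; contradiction)

-- Write ℓ(w) = ℓ̂(w) + k(w)·δ, where k(w) counts the edges of w outside H.  A path
-- has fewer than n edges, so ℓ(π) < ℓ̂(π) + n·δ, and δ ≤ ε then forces every
-- ℓ̂-shortest path to be ℓ-shortest.  Paths of H keep their length under ℓ̂, so
-- d̂_G ≤ d_H pointwise and the two sums agree iff d̂_G = d_H on V(H).  If H is
-- convex, an ℓ̂-shortest path between vertices of H is ℓ-shortest, hence lies in
-- H, giving d_H ≤ d̂_G.  Conversely, if d̂_G = d_H, an ℓ-shortest path π leaving H
-- would give d̂_G ≤ ℓ̂(π) < ℓ(π) ≤ d_H.

lookup-injective : ∀ {A : Set} {xs : List A} → Unique xs → Injective _≡_ _≡_ (lookup xs)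
lookup-injective {xs = _ ∷ _} _ {Fin.zero} {Fin.zero} _ = refl
lookup-injective (x∉xs ∷ _) {Fin.zero} {Fin.suc j} eq = contradiction eq (All.lookup x∉xs (∈-lookup j))
lookup-injective (x∉xs ∷ _) {Fin.suc i} {Fin.zero} eq = contradiction (sym eq) (All.lookup x∉xs (∈-lookup i))
lookup-injective (_ ∷ xs!) {Fin.suc i} {Fin.suc j} eq = cong Fin.suc (lookup-injective xs! eq)

length-unique≤ : ∀ {n} {xs : List (Fin n)} → Unique xs → length xs ℕ.≤ n
length-unique≤ xs! = injective⇒≤ (lookup-injective xs!)

module _ (𝔽 : OrderedField) where
  open OrderedField 𝔽
  open Over 𝔽
  open IsStrictTotalOrder isStrictTotalOrder
    using (compare; irrefl; isEquivalence; isStrictPartialOrder) renaming (trans to <-trans)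

  commutativeRing : CommutativeRing 0ℓ 0ℓ
  commutativeRing = record { isCommutativeRing = isCommutativeRing }

  open CommutativeRing commutativeRing using (+-assoc; +-comm; +-identityʳ; +-group; +-commutativeSemigroup)
  open GroupProperties +-group using (//-rightDividesˡ)
  open CommutativeSemigroupProperties +-commutativeSemigroup using (interchange)

  strictPartialOrder : StrictPartialOrder 0ℓ 0ℓ 0ℓ
  strictPartialOrder = record { isStrictPartialOrder = isStrictPartialOrder }

  open StrictPartialOrderReasoning strictPartialOrder

  ≤-antisym : ∀ {a b} → a ≤ b → b ≤ a → a ≡ b
  ≤-antisym = StrictToNonStrict.antisym _≡_ _<_ isEquivalence <-trans irrefl

  ≮⇒≥ : ∀ {a b} → ¬ b < a → a ≤ b
  ≮⇒≥ {a} {b} b≮a with compare a b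
  ... | tri< a<b _ _ = inj₁ a<b
  ... | tri≈ _ a≡b _ = inj₂ a≡b
  ... | tri> _ _ b<a = contradiction b<a b≮a

  +-monoʳ-< : ∀ {a b} c → a < b → c + a < c + b
  +-monoʳ-< {a} {b} c a<b = begin-strict
    c + a  ≡⟨ +-comm c a ⟩
    a + c  <⟨ +-mono-< c a<b ⟩
    b + c  ≡⟨ +-comm b c ⟩
    c + b  ∎

  +-monoˡ-≤ : ∀ {a b} c → a ≤ b → a + c ≤ b + c
  +-monoˡ-≤ c (inj₁ a<b)  = inj₁ (+-mono-< c a<b)
  +-monoˡ-≤ c (inj₂ refl) = inj₂ refl

  +-monoʳ-≤ : ∀ {a b} c → a ≤ b → c + a ≤ c + b
  +-monoʳ-≤ c (inj₁ a<b)  = inj₁ (+-monoʳ-< c a<b)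
  +-monoʳ-≤ c (inj₂ refl) = inj₂ refl

  +-mono-≤ : ∀ {a b c d} → a ≤ b → c ≤ d → a + c ≤ b + d
  +-mono-≤ {a} {b} {c} {d} a≤b c≤d = begin
    a + c  ≤⟨ +-monoˡ-≤ c a≤b ⟩
    b + c  ≤⟨ +-monoʳ-≤ b c≤d ⟩
    b + d  ∎

  +-mono-<-≤ : ∀ {a b c d} → a < b → c ≤ d → a + c < b + d
  +-mono-<-≤ {a} {b} {c} {d} a<b c≤d = begin-strict
    a + c  <⟨ +-mono-< c a<b ⟩
    b + c  ≤⟨ +-monoʳ-≤ b c≤d ⟩
    b + d  ∎

  +-mono-≤-equality : ∀ {a b c d} → a ≤ b → c ≤ d → a + c ≡ b + d → a ≡ b × c ≡ d
  +-mono-≤-equality     (inj₁ a<b)  c≤d        eq = contradiction (+-mono-<-≤ a<b c≤d) (irrefl eq)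
  +-mono-≤-equality {a} (inj₂ refl) (inj₁ c<d) eq = contradiction (+-monoʳ-< a c<d) (irrefl eq)
  +-mono-≤-equality     (inj₂ refl) (inj₂ refl) _  = refl , refl

  x≤y-z⇒z+x≤y : ∀ {x y z} → x ≤ y - z → z + x ≤ y
  x≤y-z⇒z+x≤y {x} {y} {z} x≤y-z = begin
    z + x        ≤⟨ +-monoʳ-≤ z x≤y-z ⟩
    z + (y - z)  ≡⟨ +-comm z (y - z) ⟩
    y - z + z    ≡⟨ //-rightDividesˡ z y ⟩
    y            ∎

  0≤· : ∀ {δ} → 0# < δ → ∀ k → 0# ≤ k · δ
  0≤·     δ>0 ℕ.zero    = inj₂ refl
  0≤· {δ} δ>0 (ℕ.suc k) = begin
    0#          ≡⟨ +-identityʳ 0# ⟨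
    0# + 0#     ≤⟨ +-mono-≤ (inj₁ δ>0) (0≤· δ>0 k) ⟩
    δ + k · δ   ∎

  ·-monoˡ-< : ∀ {δ} → 0# < δ → ∀ {m k} → m ℕ.< k → m · δ < k · δ
  ·-monoˡ-< {δ} δ>0 {ℕ.zero} {ℕ.suc k} _ = begin-strict
    0#          ≡⟨ +-identityʳ 0# ⟨
    0# + 0#     <⟨ +-mono-<-≤ δ>0 (0≤· δ>0 k) ⟩
    δ + k · δ   ∎
  ·-monoˡ-< {δ} δ>0 {ℕ.suc m} {ℕ.suc k} (ℕ.s≤s m<k) = +-monoʳ-< δ (·-monoˡ-< δ>0 m<k)

  -- a ≼ b : a is finite and a ≤ b.  Finiteness of a is needed for the
  -- equality case +∞-mono-≼-equality, as ∞ +∞ c ≡ ∞ +∞ d for all c, d.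
  infix 4 _≼_
  _≼_ : F∞ → F∞ → Set
  nothing ≼ _       = ⊥
  just a  ≼ nothing = ⊤
  just a  ≼ just b  = a ≤ b

  ≼-antisym : ∀ {a b} → a ≼ b → b ≼ a → a ≡ b
  ≼-antisym {just a} {just b} a≤b b≤a = cong just (≤-antisym a≤b b≤a)

  +∞-mono-≼ : ∀ {a b c d} → a ≼ b → c ≼ d → a +∞ c ≼ b +∞ d
  +∞-mono-≼ {just a} {just b}  {just c} {just d}  a≤b c≤d = +-mono-≤ a≤b c≤d
  +∞-mono-≼ {just a} {just b}  {just c} {nothing} _   _   = tt
  +∞-mono-≼ {just a} {nothing} {just c}           _   _   = tt

  +∞-mono-≼-equality : ∀ {a b c d} → a ≼ b → c ≼ d → a +∞ c ≡ b +∞ d → a ≡ b × c ≡ d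
  +∞-mono-≼-equality {just a} {just b} {just c} {just d} a≤b c≤d eq
    with a≡b , c≡d ← +-mono-≤-equality a≤b c≤d (just-injective eq) = cong just a≡b , cong just c≡d
  +∞-mono-≼-equality {just a} {just b}  {just c} {nothing} _ _ ()
  +∞-mono-≼-equality {just a} {nothing} {just c}           _ _ ()

  Σ∞ : {I : Set} → (I → F∞) → List I → F∞
  Σ∞ f xs = foldr _+∞_ (just 0#) (map f xs)

  Σ∞-mono-≼ : ∀ {I : Set} {f g : I → F∞} xs → All (λ i → f i ≼ g i) xs → Σ∞ f xs ≼ Σ∞ g xs
  Σ∞-mono-≼ []       []            = inj₂ refl
  Σ∞-mono-≼ (x ∷ xs) (fx≼gx ∷ f≼g) = +∞-mono-≼ fx≼gx (Σ∞-mono-≼ xs f≼g)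

  Σ∞-cong : ∀ {I : Set} {f g : I → F∞} xs → All (λ i → f i ≡ g i) xs → Σ∞ f xs ≡ Σ∞ g xs
  Σ∞-cong []       []            = refl
  Σ∞-cong (x ∷ xs) (fx≡gx ∷ f≡g) = cong₂ _+∞_ fx≡gx (Σ∞-cong xs f≡g)

  Σ∞-mono-≼-equality : ∀ {I : Set} {f g : I → F∞} xs → All (λ i → f i ≼ g i) xs →
                       Σ∞ f xs ≡ Σ∞ g xs → All (λ i → f i ≡ g i) xs
  Σ∞-mono-≼-equality []       []            _  = []
  Σ∞-mono-≼-equality (x ∷ xs) (fx≼gx ∷ f≼g) eq
    with fx≡gx , Σf≡Σg ← +∞-mono-≼-equality fx≼gx (Σ∞-mono-≼ xs f≼g) eq =
    fx≡gx ∷ Σ∞-mono-≼-equality xs f≼g Σf≡Σg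

  Σ∞-≡⇔All≡ : ∀ {I : Set} {f g : I → F∞} xs → All (λ i → f i ≼ g i) xs →
              Σ∞ f xs ≡ Σ∞ g xs ⇔ All (λ i → f i ≡ g i) xs
  Σ∞-≡⇔All≡ xs f≼g = mk⇔ (Σ∞-mono-≼-equality xs f≼g) (Σ∞-cong xs)

  All-filterᵇ-allFin⇔ : ∀ {n} {P : Fin n → Set} (V : Fin n → Bool) →
                        All P (filterᵇ V (allFin n)) ⇔ (∀ x → T (V x) → P x)
  All-filterᵇ-allFin⇔ V = mk⇔
    (λ all x Vx → All.lookup all (∈-filter⁺ (T? ∘ V) (∈-allFin x) Vx))
    (λ P-on-V → All.tabulate (λ {x} x∈ → P-on-V x (proj₂ (∈-filter⁻ (T? ∘ V) {xs = allFin _} x∈))))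

  Σ∞-filterᵇ-≡⇔ : ∀ {n} (V : Fin n → Bool) {f g : Fin n → F∞} → (∀ x → f x ≼ g x) →
                  Σ∞ f (filterᵇ V (allFin n)) ≡ Σ∞ g (filterᵇ V (allFin n)) ⇔ (∀ x → T (V x) → f x ≡ g x)
  Σ∞-filterᵇ-≡⇔ V f≼g = ⇔.trans (Σ∞-≡⇔All≡ _ (All.tabulate (λ _ → f≼g _))) (All-filterᵇ-allFin⇔ V)

  AgreeOn : ∀ {n} → (Fin n → Bool) → (Fin n → Fin n → F∞) → (Fin n → Fin n → F∞) → Set
  AgreeOn V f g = ∀ x y → T (V x) → T (V y) → f x y ≡ g x y

  sumV-≡⇔AgreeOn : ∀ {n} (V : Fin n → Bool) {f g : Fin n → Fin n → F∞} → (∀ x y → f x y ≼ g x y) →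
                   sumV V f ≡ sumV V g ⇔ AgreeOn V f g
  sumV-≡⇔AgreeOn {n} V {f} {g} f≼g = ⇔.trans rows (mk⇔
    (λ rows≡ x y Vx → Equivalence.to (row x) (rows≡ x Vx) y)
    (λ agree x Vx → Equivalence.from (row x) (λ y → agree x y Vx)))
    where
    vs : List (Fin n)
    vs = filterᵇ V (allFin n)
    row : ∀ x → Σ∞ (f x) vs ≡ Σ∞ (g x) vs ⇔ (∀ y → T (V y) → f x y ≡ g x y)
    row x = Σ∞-filterᵇ-≡⇔ V (f≼g x)
    rows : sumV V f ≡ sumV V g ⇔ (∀ x → T (V x) → Σ∞ (f x) vs ≡ Σ∞ (g x) vs)
    rows = Σ∞-filterᵇ-≡⇔ V (λ x → Σ∞-mono-≼ vs (All.tabulate (λ _ → f≼g x _)))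

  dist≼plen : ∀ {n} {A : Fin n → Fin n → Bool} {f x y d} → IsDist A f x y d →
              (p : Path A x y) → d ≼ just (plen f p)
  dist≼plen {d = nothing} no-path   p = no-path p
  dist≼plen {d = just _}  (_ , min) p = min p

  module _ {n : ℕ} {G : Graph n} (H : Subgraph G) (ℓ : Fin n → Fin n → Carrier) (δ : Carrier) where
    open Graph G using (E)
    open Subgraph H using (V; EH; EH⊆E; EH-end)

    ℓ̂ : Fin n → Fin n → Carrier
    ℓ̂ = hat H ℓ δ

    offEdges : ∀ {x y} → Walk E x y → ℕ
    offEdges [ _ ]                      = 0
    offEdges (step {x = x} {y = y} _ w) = if EH x y then offEdges w else ℕ.suc (offEdges w)

    len≡len-hat+offEdges·δ : ∀ {x y} (w : Walk E x y) → len ℓ w ≡ len ℓ̂ w + offEdges w · δ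
    len≡len-hat+offEdges·δ [ _ ] = sym (+-identityʳ 0#)
    len≡len-hat+offEdges·δ (step {x = x} {y = y} _ w) with EH x y
    ... | true  = begin-equality
      ℓ x y + len ℓ w                      ≡⟨ cong (ℓ x y +_) (len≡len-hat+offEdges·δ w) ⟩
      ℓ x y + (len ℓ̂ w + offEdges w · δ)   ≡⟨ +-assoc (ℓ x y) _ _ ⟨
      ℓ x y + len ℓ̂ w + offEdges w · δ     ∎
    ... | false = begin-equality
      ℓ x y + len ℓ w                                  ≡⟨ cong₂ _+_ (sym (//-rightDividesˡ δ (ℓ x y))) (len≡len-hat+offEdges·δ w) ⟩
      (ℓ x y - δ) + δ + (len ℓ̂ w + offEdges w · δ)     ≡⟨ interchange (ℓ x y - δ) δ (len ℓ̂ w) _ ⟩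
      (ℓ x y - δ) + len ℓ̂ w + (δ + offEdges w · δ)     ∎

    offEdges<length : ∀ {x y} (w : Walk E x y) → offEdges w ℕ.< length (vertices w)
    offEdges<length [ _ ] = ℕ.z<s
    offEdges<length (step {x = x} {y = y} _ w) with EH x y
    ... | true  = ℕ.m≤n⇒m≤1+n (offEdges<length w)
    ... | false = ℕ.s<s (offEdges<length w)

    offEdges<n : ∀ {x y} (π : Path E x y) → offEdges (Path.walk π) ℕ.< n
    offEdges<n (mkPath w w!) = ℕ.<-≤-trans (offEdges<length w) (length-unique≤ w!)

    EdgesInH : ∀ {x y} → Walk E x y → Set
    EdgesInH w = AllL (λ e → T (EH (proj₁ e) (proj₂ e))) (edges w)

    offEdges≡0⇒EdgesInH : ∀ {x y} (w : Walk E x y) → offEdges w ≡ 0 → EdgesInH w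
    offEdges≡0⇒EdgesInH [ _ ] _ = []
    offEdges≡0⇒EdgesInH (step {x = x} {y = y} _ w) off≡0 with EH x y in xy≡true
    ... | true = Equivalence.from T-≡ xy≡true ∷ offEdges≡0⇒EdgesInH w off≡0

    EdgesInH⇒offEdges≡0 : ∀ {x y} (w : Walk E x y) → EdgesInH w → offEdges w ≡ 0
    EdgesInH⇒offEdges≡0 [ _ ] _ = refl
    EdgesInH⇒offEdges≡0 (step {x = x} {y = y} _ w) (xy∈H ∷ inH) with EH x y | xy∈H
    ... | true | _ = EdgesInH⇒offEdges≡0 w inH

    EdgesInH⇒VerticesInH : ∀ {x y} (w : Walk E x y) → EdgesInH w → T (V y) →
                           AllL (λ v → T (V v)) (vertices w)
    EdgesInH⇒VerticesInH [ _ ] _ Vy = Vy ∷ []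
    EdgesInH⇒VerticesInH (step {x = x} {y = y} _ w) (xy∈H ∷ inH) Vz =
      proj₁ (EH-end x y xy∈H) ∷ EdgesInH⇒VerticesInH w inH Vz

    restrict : ∀ {x y} (w : Walk E x y) → EdgesInH w → Walk EH x y
    restrict [ x ]      _            = [ x ]
    restrict (step _ w) (xy∈H ∷ inH) = step xy∈H (restrict w inH)

    vertices-restrict : ∀ {x y} (w : Walk E x y) (inH : EdgesInH w) → vertices (restrict w inH) ≡ vertices w
    vertices-restrict [ _ ]              _         = refl
    vertices-restrict (step {x = x} _ w) (_ ∷ inH) = cong (x ∷_) (vertices-restrict w inH)

    len-restrict : ∀ f {x y} (w : Walk E x y) (inH : EdgesInH w) → len f (restrict w inH) ≡ len f w
    len-restrict f [ _ ]                      _         = refl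
    len-restrict f (step {x = x} {y = y} _ w) (_ ∷ inH) = cong (f x y +_) (len-restrict f w inH)

    lift : ∀ {x y} → Walk EH x y → Walk E x y
    lift [ x ]                         = [ x ]
    lift (step {x = x} {y = y} xy∈H w) = step (EH⊆E x y xy∈H) (lift w)

    vertices-lift : ∀ {x y} (w : Walk EH x y) → vertices (lift w) ≡ vertices w
    vertices-lift [ _ ]              = refl
    vertices-lift (step {x = x} _ w) = cong (x ∷_) (vertices-lift w)

    len-lift : ∀ f {x y} (w : Walk EH x y) → len f (lift w) ≡ len f w
    len-lift f [ _ ]                      = refl
    len-lift f (step {x = x} {y = y} _ w) = cong (f x y +_) (len-lift f w)

    EdgesInH-lift : ∀ {x y} (w : Walk EH x y) → EdgesInH (lift w)
    EdgesInH-lift [ _ ]         = []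
    EdgesInH-lift (step xy∈H w) = xy∈H ∷ EdgesInH-lift w

    restrictPath : ∀ {x y} (π : Path E x y) → EdgesInH (Path.walk π) → Path EH x y
    restrictPath (mkPath w w!) inH = mkPath (restrict w inH) (subst Unique (sym (vertices-restrict w inH)) w!)

    liftPath : ∀ {x y} → Path EH x y → Path E x y
    liftPath (mkPath w w!) = mkPath (lift w) (subst Unique (sym (vertices-lift w)) w!)

    len-hat≤len : 0# < δ → ∀ {x y} (w : Walk E x y) → len ℓ̂ w ≤ len ℓ w
    len-hat≤len δ>0 w = begin
      len ℓ̂ w                    ≡⟨ +-identityʳ (len ℓ̂ w) ⟨
      len ℓ̂ w + 0#               ≤⟨ +-monoʳ-≤ (len ℓ̂ w) (0≤· δ>0 (offEdges w)) ⟩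
      len ℓ̂ w + offEdges w · δ   ≡⟨ len≡len-hat+offEdges·δ w ⟨
      len ℓ w                    ∎

    len-hat<len : 0# < δ → ∀ {x y} (w : Walk E x y) → offEdges w ≢ 0 → len ℓ̂ w < len ℓ w
    len-hat<len δ>0 w off≢0 = begin-strict
      len ℓ̂ w                    ≡⟨ +-identityʳ (len ℓ̂ w) ⟨
      len ℓ̂ w + 0 · δ            <⟨ +-monoʳ-< (len ℓ̂ w) (·-monoˡ-< δ>0 (ℕ.n≢0⇒n>0 off≢0)) ⟩
      len ℓ̂ w + offEdges w · δ   ≡⟨ len≡len-hat+offEdges·δ w ⟨
      len ℓ w                    ∎

    len-hat≡len : ∀ {x y} (w : Walk E x y) → EdgesInH w → len ℓ̂ w ≡ len ℓ w
    len-hat≡len w inH = begin-equality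
      len ℓ̂ w                    ≡⟨ +-identityʳ (len ℓ̂ w) ⟨
      len ℓ̂ w + 0 · δ            ≡⟨ cong (λ k → len ℓ̂ w + k · δ) (EdgesInH⇒offEdges≡0 w inH) ⟨
      len ℓ̂ w + offEdges w · δ   ≡⟨ len≡len-hat+offEdges·δ w ⟨
      len ℓ w                    ∎

    plen<plen-hat+n·δ : 0# < δ → ∀ {x y} (π : Path E x y) → plen ℓ π < plen ℓ̂ π + n · δ
    plen<plen-hat+n·δ δ>0 π = begin-strict
      plen ℓ π                               ≡⟨ len≡len-hat+offEdges·δ (Path.walk π) ⟩
      plen ℓ̂ π + offEdges (Path.walk π) · δ  <⟨ +-monoʳ-< (plen ℓ̂ π) (·-monoˡ-< δ>0 (offEdges<n π)) ⟩
      plen ℓ̂ π + n · δ                       ∎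

    plen-hat-liftPath : ∀ {x y} (σ : Path EH x y) → plen ℓ̂ (liftPath σ) ≡ plen ℓ σ
    plen-hat-liftPath (mkPath w _) = trans (len-hat≡len (lift w) (EdgesInH-lift w)) (len-lift ℓ w)

    plen-restrictPath : ∀ {x y} (π : Path E x y) (inH : EdgesInH (Path.walk π)) →
                        plen ℓ (restrictPath π inH) ≡ plen ℓ̂ π
    plen-restrictPath (mkPath w _) inH = trans (len-restrict ℓ w inH) (sym (len-hat≡len w inH))

    hat-shortest⇒shortest : 0# < δ → δ≤ε G ℓ δ → ∀ {x y} (π̂ : Path E x y) →
                            Shortest G ℓ̂ π̂ → Shortest G ℓ π̂
    hat-shortest⇒shortest δ>0 δ-small π̂ π̂-hat-shortest π′ = ≮⇒≥ λ π′<π̂ → begin-contradiction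
      plen ℓ π̂            <⟨ plen<plen-hat+n·δ δ>0 π̂ ⟩
      plen ℓ̂ π̂ + n · δ    ≤⟨ +-monoˡ-≤ (n · δ) (π̂-hat-shortest π′) ⟩
      plen ℓ̂ π′ + n · δ   ≤⟨ +-monoˡ-≤ (n · δ) (len-hat≤len δ>0 (Path.walk π′)) ⟩
      plen ℓ π′ + n · δ   ≤⟨ x≤y-z⇒z+x≤y (δ-small π̂ π′ π′<π̂) ⟩
      plen ℓ π̂            ∎

    hat-dist≼dist-H : Connected G → ∀ {x y d̂ d} → IsDist E ℓ̂ x y d̂ → IsDist EH ℓ x y d → d̂ ≼ d
    hat-dist≼dist-H conn {x} {y} {nothing} no-path _ = no-path (conn x y)
    hat-dist≼dist-H conn {d̂ = just _} {nothing} _ _ = tt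
    hat-dist≼dist-H conn {d̂ = just a} {just b} (_ , a-min) ((σ , ℓσ≡b) , _) = begin
      a                     ≤⟨ a-min (liftPath σ) ⟩
      plen ℓ̂ (liftPath σ)   ≡⟨ plen-hat-liftPath σ ⟩
      plen ℓ σ              ≡⟨ ℓσ≡b ⟩
      b                     ∎

    convex⇒hat-dist≡dist-H : Connected G → 0# < δ → δ≤ε G ℓ δ → Convex H ℓ →
                             ∀ {x y d̂ d} → T (V x) → T (V y) →
                             IsDist E ℓ̂ x y d̂ → IsDist EH ℓ x y d → d̂ ≡ d
    convex⇒hat-dist≡dist-H conn _ _ _ {x} {y} {nothing} _ _ no-path _ = contradiction (conn x y) no-path
    convex⇒hat-dist≡dist-H conn δ>0 δ-small convex {x} {y} {just a} {d} Vx Vy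
                           d̂-dist@((π̂ , ℓ̂π̂≡a) , a-min) d-dist =
      ≼-antisym (hat-dist≼dist-H conn d̂-dist d-dist) d≼a
      where
      π̂-shortest : Shortest G ℓ π̂
      π̂-shortest = hat-shortest⇒shortest δ>0 δ-small π̂ (λ π′ → subst (_≤ plen ℓ̂ π′) (sym ℓ̂π̂≡a) (a-min π′))
      π̂-in-H : EdgesInH (Path.walk π̂)
      π̂-in-H = proj₂ (convex x y Vx Vy π̂ π̂-shortest)
      d≼a : d ≼ just a
      d≼a = subst (λ v → d ≼ just v) (trans (plen-restrictPath π̂ π̂-in-H) ℓ̂π̂≡a)
                  (dist≼plen d-dist (restrictPath π̂ π̂-in-H))

    hat-dist≡dist-H⇒shortest⊆H : 0# < δ → ∀ {x y d} → T (V y) → IsDist E ℓ̂ x y d → IsDist EH ℓ x y d →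
                                 (π : Path E x y) → Shortest G ℓ π → ContainedIn H π
    hat-dist≡dist-H⇒shortest⊆H _ {d = nothing} _ no-path _ π _ = contradiction π no-path
    hat-dist≡dist-H⇒shortest⊆H δ>0 {d = just a} Vy (_ , a-min) ((σ , ℓσ≡a) , _) π π-shortest
      with offEdges (Path.walk π) ℕ.≟ 0
    ... | yes off≡0 = EdgesInH⇒VerticesInH (Path.walk π) π-in-H Vy , π-in-H
      where
      π-in-H : EdgesInH (Path.walk π)
      π-in-H = offEdges≡0⇒EdgesInH (Path.walk π) off≡0
    ... | no off≢0 = begin-contradiction
      a                     ≤⟨ a-min π ⟩
      plen ℓ̂ π              <⟨ len-hat<len δ>0 (Path.walk π) off≢0 ⟩
      plen ℓ π              ≤⟨ π-shortest (liftPath σ) ⟩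
      plen ℓ (liftPath σ)   ≡⟨ len-lift ℓ (Path.walk σ) ⟩
      plen ℓ σ              ≡⟨ ℓσ≡a ⟩
      a                     ∎

    convex⇔AgreeOn : Connected G → 0# < δ → δ≤ε G ℓ δ → {d̂ d : Fin n → Fin n → F∞} →
                     (∀ x y → IsDist E ℓ̂ x y (d̂ x y)) → (∀ x y → IsDist EH ℓ x y (d x y)) →
                     Convex H ℓ ⇔ AgreeOn V d̂ d
    convex⇔AgreeOn conn δ>0 δ-small d̂-dist d-dist = mk⇔
      (λ convex x y Vx Vy → convex⇒hat-dist≡dist-H conn δ>0 δ-small convex Vx Vy (d̂-dist x y) (d-dist x y))
      (λ agree x y Vx Vy → hat-dist≡dist-H⇒shortest⊆H δ>0 Vy (d̂-dist x y)
                             (subst (IsDist EH ℓ x y) (sym (agree x y Vx Vy)) (d-dist x y)))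

lemma6 : (𝔽 : OrderedField) → let open OrderedField 𝔽 in let open Over 𝔽 in
    (n : ℕ) (G : Graph n) (ℓ : Fin n → Fin n → Carrier) →
    Connected G → PositiveLengths G ℓ →
    (H : Subgraph G) (δ : Carrier) → 0# < δ → δ≤ε G ℓ δ →
    (d̂G dH : Fin n → Fin n → F∞) →
    (∀ x y → IsDist (Graph.E G) (hat H ℓ δ) x y (d̂G x y)) →
    (∀ x y → IsDist (Subgraph.EH H) ℓ x y (dH x y)) →
    (Convex H ℓ ⇔ (sumV (Subgraph.V H) d̂G ≡ sumV (Subgraph.V H) dH))
lemma6 𝔽 n G ℓ conn _ H δ δ>0 δ-small d̂G dH d̂G-dist dH-dist =
  ⇔.trans (convex⇔AgreeOn 𝔽 H ℓ δ conn δ>0 δ-small d̂G-dist dH-dist)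
          (⇔.sym (sumV-≡⇔AgreeOn 𝔽 (Subgraph.V H) λ x y → hat-dist≼dist-H 𝔽 H ℓ δ conn (d̂G-dist x y) (dH-dist x y)))
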